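{- Let $X_1\xleftarrow{\zeta_1}S'\xrightarrow{\zeta_2}X_2$ and $X_1\xleftarrow{\pi_1}B\xrightarrow{\pi_2}X_2$ be spans in $\mathcal C$ between $T$-coalgebras $(X_1,\gamma_1)$ and $(X_2,\gamma_2)$, and suppose $e\colon S'\to B$ is an epimorphism with $\zeta_i=\pi_i\circ e$ for $i=1,2$. Then $(S',\zeta_1,\zeta_2)$ satisfies the $\rho$-bisimulation equation if and only if $(B,\pi_1,\pi_2)$ does.
   Context: $P\colon\mathcal C\to\mathcal A$, $S\colon\mathcal A\to\mathcal C$ are contravariant functors forming a dual adjunction (a bijection $\mathcal C(X,SA)\cong\mathcal A(A,PX)$ natural in $X,A$). $T\colon\mathcal C\to\mathcal C$ is an endofunctor; a $T$-coalgebra is $(X,\gamma)$ with $\gamma\colon X\to TX$. $(L,\rho)$ is a logic for $T$-coalgebras: $L\colon\mathcal A\to\mathcal A$ an endofunctor and $\rho\colon LP\to PT$ natural; the complex algebra of $(X,\gamma)$ is $\gamma^*=P\gamma\circ\rho_X\colon LPX\to PX$. Standing assumptions: $\mathcal C$ is finitely complete and well-powered and has an $(\mathcal E,\mathrm{Mono})$-factorisation system; $\mathcal A$ has pullbacks or $\mathcal C$ has pushouts. For any span $X_1\xleftarrow{s_1}R\xrightarrow{s_2}X_2$, its dual span $(\bar R,\bar s_1,\bar s_2)$ is the pullback in $\mathcal A$ of $PX_1\xrightarrow{Ps_1}PR\xleftarrow{Ps_2}PX_2$, and the span satisfies the $\rho$-bisimulation equation if $Ps_1\circ\gamma_1^*\circ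 L\bar s_1=Ps_2\circ\gamma_2^*\circ L\bar s_2$. -}

module Defs where

open import Level using (Level; _⊔_; suc)
open import Relation.Binary using (IsEquivalence)
open import Data.Product using (Σ; _×_; _,_)
open import Function using (_⇔_)

record Category (o ℓ e : Level) : Set (suc (o ⊔ ℓ ⊔ e)) where
  infixr 9 _∘_
  infix  4 _≈_
  field
    Obj   : Set o
    Hom   : Obj → Obj → Set ℓ
    _≈_   : ∀ {A B} → Hom A B → Hom A B → Set e
    id    : ∀ {A} → Hom A A
    _∘_   : ∀ {A B C} → Hom B C → Hom A B → Hom A C
    equiv : ∀ {A B} → IsEquivalence (_≈_ {A} {B})
    ∘-resp-≈ : ∀ {A B C} {f h : Hom B C} {g i : Hom A B} →
               f ≈ h → g ≈ i → f ∘ g ≈ h ∘ i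
    identityˡ : ∀ {A B} {f : Hom A B} → id ∘ f ≈ f
    identityʳ : ∀ {A B} {f : Hom A B} → f ∘ id ≈ f
    assoc : ∀ {A B C D} {f : Hom A B} {g : Hom B C} {h : Hom C D} →
            (h ∘ g) ∘ f ≈ h ∘ (g ∘ f)

module _ {o ℓ e} (C : Category o ℓ e) where
  open Category C

  IsEpi : ∀ {A B} → Hom A B → Set (o ⊔ ℓ ⊔ e)
  IsEpi {A} {B} f = ∀ {Z} (g h : Hom B Z) → g ∘ f ≈ h ∘ f → g ≈ h

  record Pullback {A₁ A₂ Z : Obj} (f : Hom A₁ Z) (g : Hom A₂ Z)
         : Set (o ⊔ ℓ ⊔ e) where
    field
      P        : Obj
      p₁       : Hom P A₁
      p₂       : Hom P A₂
      commute  : f ∘ p₁ ≈ g ∘ p₂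
      universal : ∀ {Q} (q₁ : Hom Q A₁) (q₂ : Hom Q A₂) → f ∘ q₁ ≈ g ∘ q₂ →
                  Hom Q P
      p₁∘universal : ∀ {Q} {q₁ : Hom Q A₁} {q₂ : Hom Q A₂}
                     (eq : f ∘ q₁ ≈ g ∘ q₂) → p₁ ∘ universal q₁ q₂ eq ≈ q₁
      p₂∘universal : ∀ {Q} {q₁ : Hom Q A₁} {q₂ : Hom Q A₂}
                     (eq : f ∘ q₁ ≈ g ∘ q₂) → p₂ ∘ universal q₁ q₂ eq ≈ q₂
      unique   : ∀ {Q} {q₁ : Hom Q A₁} {q₂ : Hom Q A₂}
                 (eq : f ∘ q₁ ≈ g ∘ q₂) (u : Hom Q P) →
                 p₁ ∘ u ≈ q₁ → p₂ ∘ u ≈ q₂ → u ≈ universal q₁ q₂ eq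

record Functor {o ℓ e o′ ℓ′ e′} (C : Category o ℓ e) (D : Category o′ ℓ′ e′)
       : Set (o ⊔ ℓ ⊔ e ⊔ o′ ⊔ ℓ′ ⊔ e′) where
  private
    module C = Category C
    module D = Category D
  field
    F₀ : C.Obj → D.Obj
    F₁ : ∀ {A B} → C.Hom A B → D.Hom (F₀ A) (F₀ B)
    F-resp-≈ : ∀ {A B} {f g : C.Hom A B} → f C.≈ g → F₁ f D.≈ F₁ g
    identity : ∀ {A} → F₁ (C.id {A}) D.≈ D.id
    homomorphism : ∀ {A B Z} {f : C.Hom A B} {g : C.Hom B Z} →
                   F₁ (g C.∘ f) D.≈ F₁ g D.∘ F₁ f

record ContravariantFunctor {o ℓ e o′ ℓ′ e′}
       (C : Category o ℓ e) (D : Category o′ ℓ′ e′)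
       : Set (o ⊔ ℓ ⊔ e ⊔ o′ ⊔ ℓ′ ⊔ e′) where
  private
    module C = Category C
    module D = Category D
  field
    F₀ : C.Obj → D.Obj
    F₁ : ∀ {A B} → C.Hom A B → D.Hom (F₀ B) (F₀ A)
    F-resp-≈ : ∀ {A B} {f g : C.Hom A B} → f C.≈ g → F₁ f D.≈ F₁ g
    identity : ∀ {A} → F₁ (C.id {A}) D.≈ D.id
    homomorphism : ∀ {A B Z} {f : C.Hom A B} {g : C.Hom B Z} →
                   F₁ (g C.∘ f) D.≈ F₁ f D.∘ F₁ g

record DualAdjunction {o ℓ e o′ ℓ′ e′}
       {C : Category o ℓ e} {A : Category o′ ℓ′ e′}
       (P : ContravariantFunctor C A) (S : ContravariantFunctor A C)
       : Set (o ⊔ ℓ ⊔ e ⊔ o′ ⊔ ℓ′ ⊔ e′) where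
  private
    module C = Category C
    module A = Category A
    module P = ContravariantFunctor P
    module S = ContravariantFunctor S
  field
    φ   : ∀ {X a} → C.Hom X (S.F₀ a) → A.Hom a (P.F₀ X)
    φ⁻¹ : ∀ {X a} → A.Hom a (P.F₀ X) → C.Hom X (S.F₀ a)
    φ-resp-≈   : ∀ {X a} {h k : C.Hom X (S.F₀ a)} → h C.≈ k → φ h A.≈ φ k
    φ⁻¹-resp-≈ : ∀ {X a} {h k : A.Hom a (P.F₀ X)} → h A.≈ k → φ⁻¹ h C.≈ φ⁻¹ k
    φ⁻¹∘φ : ∀ {X a} (h : C.Hom X (S.F₀ a)) → φ⁻¹ (φ h) C.≈ h
    φ∘φ⁻¹ : ∀ {X a} (h : A.Hom a (P.F₀ X)) → φ (φ⁻¹ h) A.≈ h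
    natural : ∀ {X X′ a a′} (f : C.Hom X′ X) (g : A.Hom a′ a)
              (h : C.Hom X (S.F₀ a)) →
              φ (S.F₁ g C.∘ (h C.∘ f)) A.≈ P.F₁ f A.∘ (φ h A.∘ g)

module Setting {o ℓ e o′ ℓ′ e′}
  (C : Category o ℓ e) (A : Category o′ ℓ′ e′)
  (P : ContravariantFunctor C A)
  (T : Functor C C)
  (L : Functor A A)
  where
  private
    module C = Category C
    module A = Category A
    module P = ContravariantFunctor P
    module T = Functor T
    module L = Functor L

  record Logic : Set (o ⊔ ℓ ⊔ e ⊔ o′ ⊔ ℓ′ ⊔ e′) where
    field
      ρ : ∀ X → A.Hom (L.F₀ (P.F₀ X)) (P.F₀ (T.F₀ X))
      ρ-natural : ∀ {X Y} (f : C.Hom X Y) →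
                  P.F₁ (T.F₁ f) A.∘ ρ Y A.≈ ρ X A.∘ L.F₁ (P.F₁ f)

  record Coalgebra : Set (o ⊔ ℓ) where
    constructor coalgebra
    field
      X : C.Obj
      γ : C.Hom X (T.F₀ X)

  carrier : Coalgebra → C.Obj
  carrier = Coalgebra.X

  complexAlgebra : Logic → (c : Coalgebra) →
                   A.Hom (L.F₀ (P.F₀ (Coalgebra.X c))) (P.F₀ (Coalgebra.X c))
  complexAlgebra lg c = P.F₁ (Coalgebra.γ c) A.∘ Logic.ρ lg (Coalgebra.X c)

  record Span (X₁ X₂ : C.Obj) : Set (o ⊔ ℓ) where
    constructor span
    field
      R  : C.Obj
      s₁ : C.Hom R X₁
      s₂ : C.Hom R X₂

  DualSpan : ∀ {X₁ X₂} → Span X₁ X₂ → Set (o′ ⊔ ℓ′ ⊔ e′)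
  DualSpan (span R s₁ s₂) = Pullback A (P.F₁ s₁) (P.F₁ s₂)

  BisimEquation : (lg : Logic) (c₁ c₂ : Coalgebra)
                  (sp : Span (Coalgebra.X c₁) (Coalgebra.X c₂)) →
                  DualSpan sp → Set e′
  BisimEquation lg c₁ c₂ (span R s₁ s₂) d =
    P.F₁ s₁ A.∘ (complexAlgebra lg c₁ A.∘ L.F₁ (Pullback.p₁ d))
      A.≈ P.F₁ s₂ A.∘ (complexAlgebra lg c₂ A.∘ L.F₁ (Pullback.p₂ d))

{-# OPTIONS --safe #-}
-- Since e is epi and P is part of a dual adjunction, P e is mono.  Writing
-- P ζᵢ = P e ∘ P πᵢ, cancelling P e shows both that the two bisimulation
-- equations agree when evaluated on the same pair of legs, and that the dual
-- spans of the two spans are pullbacks of cospans with the same cones.  The two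
-- dual spans therefore factor through each other over their projections, and
-- the bisimulation equation is stable under precomposing the legs.
module Submission where

open import Defs
open import Level using (_⊔_)
open import Function using (_⇔_; mk⇔; Equivalence)
open import Function.Properties.Equivalence using () renaming (trans to ⇔-trans)
open import Relation.Binary using (IsEquivalence; Setoid)
import Relation.Binary.Reasoning.Setoid as SetoidReasoning

module CategoryProperties {o ℓ e} (𝒞 : Category o ℓ e) where
  open Category 𝒞 public

  module Equiv {X Y : Obj} = IsEquivalence (equiv {X} {Y})

  hom-setoid : Obj → Obj → Setoid ℓ e
  hom-setoid X Y = record { isEquivalence = equiv {X} {Y} }

  module HomReasoning {X Y : Obj} = SetoidReasoning (hom-setoid X Y)
  open HomReasoning

  IsMono : ∀ {X Y} → Hom X Y → Set (o ⊔ ℓ ⊔ e)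
  IsMono {X} f = ∀ {Z} (g h : Hom Z X) → f ∘ g ≈ f ∘ h → g ≈ h

  ∘-resp-≈ˡ : ∀ {X Y Z} {f h : Hom Y Z} {g : Hom X Y} → f ≈ h → f ∘ g ≈ h ∘ g
  ∘-resp-≈ˡ f≈h = ∘-resp-≈ f≈h Equiv.refl

  ∘-resp-≈ʳ : ∀ {X Y Z} {f : Hom Y Z} {g i : Hom X Y} → g ≈ i → f ∘ g ≈ f ∘ i
  ∘-resp-≈ʳ g≈i = ∘-resp-≈ Equiv.refl g≈i

  square-⇔-through-mono : ∀ {U V W Y Z} {m : Hom Y Z}
    {f₁ : Hom V Z} {f₂ : Hom W Z} {h₁ : Hom V Y} {h₂ : Hom W Y}
    {a : Hom U V} {b : Hom U W} →
    IsMono m → f₁ ≈ m ∘ h₁ → f₂ ≈ m ∘ h₂ →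
    (f₁ ∘ a ≈ f₂ ∘ b) ⇔ (h₁ ∘ a ≈ h₂ ∘ b)
  square-⇔-through-mono {m = m} {f₁} {f₂} {h₁} {h₂} {a} {b} mono f₁≈ f₂≈ =
    mk⇔ (λ sq → mono _ _ (begin
          m ∘ (h₁ ∘ a)  ≈⟨ assoc ⟨
          (m ∘ h₁) ∘ a  ≈⟨ ∘-resp-≈ˡ f₁≈ ⟨
          f₁ ∘ a        ≈⟨ sq ⟩
          f₂ ∘ b        ≈⟨ ∘-resp-≈ˡ f₂≈ ⟩
          (m ∘ h₂) ∘ b  ≈⟨ assoc ⟩
          m ∘ (h₂ ∘ b)  ∎))
        (λ sq → begin
          f₁ ∘ a        ≈⟨ ∘-resp-≈ˡ f₁≈ ⟩
          (m ∘ h₁) ∘ a  ≈⟨ assoc ⟩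
          m ∘ (h₁ ∘ a)  ≈⟨ ∘-resp-≈ʳ sq ⟩
          m ∘ (h₂ ∘ b)  ≈⟨ assoc ⟨
          (m ∘ h₂) ∘ b  ≈⟨ ∘-resp-≈ˡ f₂≈ ⟨
          f₂ ∘ b        ∎)

module DualAdjunctionProperties {o ℓ e o′ ℓ′ e′}
  {𝒞 : Category o ℓ e} {𝒜 : Category o′ ℓ′ e′}
  {P : ContravariantFunctor 𝒞 𝒜} {S : ContravariantFunctor 𝒜 𝒞}
  (adj : DualAdjunction P S) where
  private
    module C = CategoryProperties 𝒞
    module A = CategoryProperties 𝒜
    module P = ContravariantFunctor P
    module S = ContravariantFunctor S
  open DualAdjunction adj

  φ-∘ʳ : ∀ {X X′ a} (h : C.Hom X (S.F₀ a)) (f : C.Hom X′ X) →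
         φ (h C.∘ f) A.≈ P.F₁ f A.∘ φ h
  φ-∘ʳ h f = begin
    φ (h C.∘ f)                        ≈⟨ φ-resp-≈ (C.identityˡ {f = h C.∘ f}) ⟨
    φ (C.id C.∘ (h C.∘ f))             ≈⟨ φ-resp-≈ (C.∘-resp-≈ S.identity C.Equiv.refl) ⟨
    φ (S.F₁ A.id C.∘ (h C.∘ f))        ≈⟨ natural f A.id h ⟩
    P.F₁ f A.∘ (φ h A.∘ A.id)          ≈⟨ A.∘-resp-≈ʳ A.identityʳ ⟩
    P.F₁ f A.∘ φ h                     ∎
    where open A.HomReasoning

  epi⇒P-mono : ∀ {X Y} {f : C.Hom X Y} → IsEpi 𝒞 f → A.IsMono (P.F₁ f)
  epi⇒P-mono {f = f} epi g h Pf∘g≈Pf∘h = begin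
    g               ≈⟨ φ∘φ⁻¹ g ⟨
    φ (φ⁻¹ g)       ≈⟨ φ-resp-≈ (epi _ _ transposes-agree) ⟩
    φ (φ⁻¹ h)       ≈⟨ φ∘φ⁻¹ h ⟩
    h               ∎
    where
    open A.HomReasoning
    transposes-agree : φ⁻¹ g C.∘ f C.≈ φ⁻¹ h C.∘ f
    transposes-agree = C.Equiv.trans (C.Equiv.sym (φ⁻¹∘φ _))
      (C.Equiv.trans (φ⁻¹-resp-≈ (begin
        φ (φ⁻¹ g C.∘ f)         ≈⟨ φ-∘ʳ (φ⁻¹ g) f ⟩
        P.F₁ f A.∘ φ (φ⁻¹ g)    ≈⟨ A.∘-resp-≈ʳ (φ∘φ⁻¹ g) ⟩
        P.F₁ f A.∘ g            ≈⟨ Pf∘g≈Pf∘h ⟩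
        P.F₁ f A.∘ h            ≈⟨ A.∘-resp-≈ʳ (φ∘φ⁻¹ h) ⟨
        P.F₁ f A.∘ φ (φ⁻¹ h)    ≈⟨ φ-∘ʳ (φ⁻¹ h) f ⟨
        φ (φ⁻¹ h C.∘ f)         ∎))
      (φ⁻¹∘φ _))

module BisimEquationProperties {o ℓ e o′ ℓ′ e′}
  (𝒞 : Category o ℓ e) (𝒜 : Category o′ ℓ′ e′)
  (P : ContravariantFunctor 𝒞 𝒜) (T : Functor 𝒞 𝒞) (L : Functor 𝒜 𝒜)
  (lg : Setting.Logic 𝒞 𝒜 P T L) (c₁ c₂ : Setting.Coalgebra 𝒞 𝒜 P T L)
  where
  private
    module C = Category 𝒞
    module P = ContravariantFunctor P
    module L = Functor L
  open CategoryProperties 𝒜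
  open HomReasoning
  open Setting 𝒞 𝒜 P T L

  -- BisimEquation (span R s₁ s₂) d is BisimEquationAt s₁ s₂ (p₁ d) (p₂ d).
  BisimEquationAt : ∀ {R Q} →
    C.Hom R (carrier c₁) → C.Hom R (carrier c₂) →
    Hom Q (P.F₀ (carrier c₁)) → Hom Q (P.F₀ (carrier c₂)) → Set e′
  BisimEquationAt s₁ s₂ q₁ q₂ =
    P.F₁ s₁ ∘ (complexAlgebra lg c₁ ∘ L.F₁ q₁)
      ≈ P.F₁ s₂ ∘ (complexAlgebra lg c₂ ∘ L.F₁ q₂)

  ∘-L-factor : ∀ {U V W Y Z} {f : Hom W Z} {g : Hom (L.F₀ V) W}
    {q : Hom U V} {w : Hom Y U} {q′ : Hom Y V} → q ∘ w ≈ q′ →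
    f ∘ (g ∘ L.F₁ q′) ≈ (f ∘ (g ∘ L.F₁ q)) ∘ L.F₁ w
  ∘-L-factor {f = f} {g} {q} {w} {q′} q∘w≈q′ = begin
    f ∘ (g ∘ L.F₁ q′)               ≈⟨ ∘-resp-≈ʳ (∘-resp-≈ʳ (L.F-resp-≈ q∘w≈q′)) ⟨
    f ∘ (g ∘ L.F₁ (q ∘ w))          ≈⟨ ∘-resp-≈ʳ (∘-resp-≈ʳ L.homomorphism) ⟩
    f ∘ (g ∘ (L.F₁ q ∘ L.F₁ w))     ≈⟨ ∘-resp-≈ʳ assoc ⟨
    f ∘ ((g ∘ L.F₁ q) ∘ L.F₁ w)     ≈⟨ assoc ⟨
    (f ∘ (g ∘ L.F₁ q)) ∘ L.F₁ w     ∎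

  bisimEquationAt-∘ʳ : ∀ {R Q Q′}
    {s₁ : C.Hom R (carrier c₁)} {s₂ : C.Hom R (carrier c₂)}
    {q₁ : Hom Q (P.F₀ (carrier c₁))} {q₂ : Hom Q (P.F₀ (carrier c₂))}
    {q₁′ : Hom Q′ (P.F₀ (carrier c₁))} {q₂′ : Hom Q′ (P.F₀ (carrier c₂))}
    (w : Hom Q′ Q) → q₁ ∘ w ≈ q₁′ → q₂ ∘ w ≈ q₂′ →
    BisimEquationAt s₁ s₂ q₁ q₂ → BisimEquationAt s₁ s₂ q₁′ q₂′
  bisimEquationAt-∘ʳ w q₁∘w≈q₁′ q₂∘w≈q₂′ eq = begin
    _   ≈⟨ ∘-L-factor q₁∘w≈q₁′ ⟩
    _   ≈⟨ ∘-resp-≈ˡ eq ⟩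
    _   ≈⟨ ∘-L-factor q₂∘w≈q₂′ ⟨
    _   ∎

lemma3p9 : ∀ {o ℓ e o′ ℓ′ e′}
    (C : Category o ℓ e) (A : Category o′ ℓ′ e′)
    (P : ContravariantFunctor C A) (S : ContravariantFunctor A C)
    (adj : DualAdjunction P S)
    (T : Functor C C) (L : Functor A A)
    (lg : Setting.Logic C A P T L)
    (c₁ c₂ : Setting.Coalgebra C A P T L)
    (S′ B : Category.Obj C)
    (ζ₁ : Category.Hom C S′ (Setting.carrier C A P T L c₁))
    (ζ₂ : Category.Hom C S′ (Setting.carrier C A P T L c₂))
    (π₁ : Category.Hom C B (Setting.carrier C A P T L c₁))
    (π₂ : Category.Hom C B (Setting.carrier C A P T L c₂))
    (e : Category.Hom C S′ B) →
    IsEpi C e →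
    Category._≈_ C ζ₁ (Category._∘_ C π₁ e) →
    Category._≈_ C ζ₂ (Category._∘_ C π₂ e) →
    (d′ : Setting.DualSpan C A P T L (Setting.span S′ ζ₁ ζ₂))
    (dB : Setting.DualSpan C A P T L (Setting.span B π₁ π₂)) →
    Setting.BisimEquation C A P T L lg c₁ c₂ (Setting.span S′ ζ₁ ζ₂) d′
    ⇔ Setting.BisimEquation C A P T L lg c₁ c₂ (Setting.span B π₁ π₂) dB
lemma3p9 C A P S adj T L lg c₁ c₂ S′ B ζ₁ ζ₂ π₁ π₂ e epi ζ₁≈π₁∘e ζ₂≈π₂∘e d′ dB =
  ⇔-trans squares-through-Pe
    (mk⇔ (bisimEquationAt-∘ʳ dB→d′ (d′.p₁∘universal _) (d′.p₂∘universal _))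
         (bisimEquationAt-∘ʳ d′→dB (dB.p₁∘universal _) (dB.p₂∘universal _)))
  where
  open CategoryProperties A
  open BisimEquationProperties C A P T L lg c₁ c₂
  module P = ContravariantFunctor P
  module d′ = Pullback d′
  module dB = Pullback dB

  squares-through-Pe : ∀ {Q}
    {a : Hom Q (P.F₀ (Setting.carrier C A P T L c₁))}
    {b : Hom Q (P.F₀ (Setting.carrier C A P T L c₂))} →
    (P.F₁ ζ₁ ∘ a ≈ P.F₁ ζ₂ ∘ b) ⇔ (P.F₁ π₁ ∘ a ≈ P.F₁ π₂ ∘ b)
  squares-through-Pe = square-⇔-through-mono
    (DualAdjunctionProperties.epi⇒P-mono adj epi)
    (Equiv.trans (P.F-resp-≈ ζ₁≈π₁∘e) P.homomorphism)
    (Equiv.trans (P.F-resp-≈ ζ₂≈π₂∘e) P.homomorphism)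

  d′→dB : Hom d′.P dB.P
  d′→dB = dB.universal d′.p₁ d′.p₂ (Equivalence.to squares-through-Pe d′.commute)

  dB→d′ : Hom dB.P d′.P
  dB→d′ = d′.universal dB.p₁ dB.p₂ (Equivalence.from squares-through-Pe dB.commute)
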